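{- Let $L_0\subseteq L_1\subseteq L$ be logics, each an extension of the previous one, and let $F_1\dashv G_1$ and $F_2\dashv G_2$ be the Galois connections associated with the extensions $L_1$ of $L_0$ and $L$ of $L_1$ respectively. Let $T_0$ be a theory of $L_0$, $T_1=F_1(T_0)$ and $T=F_2(T_1)$. If $T_1$ is Hilbert-Post complete with respect to $L_0$ and $T$ is Hilbert-Post complete with respect to $L_1$, then $T$ is Hilbert-Post complete with respect to $L_0$ (where $L$ is viewed as an extension of $L_0$ with Galois connection $F_2\circ F_1\dashv G_1\circ G_2$).
   Context: A logic consists of a language (a set of formulas) together with deduction rules. A theory is a deductively closed set of formulas. In a given logic, $T_{\max}$ denotes the maximal theory (all formulas); a theory $T$ is consistent if $T\neq T_{\max}$. For theories $T,T'$, $T+T'$ denotes the theory generated by $T\cup T'$. If a logic $L'$ is an extension of a logic $L''$ (formulas of $L''$ are formulas of $L'$), the associated Galois connection $F\dashv G$ is given by: $F(T'')$ is the theory of $L'$ generated by a theory $T''$ of $L''$, and $G(T')$ is the theory of $L''$ consisting of the theorems of $T'$ that are formulas of $L''$; thus $F(T'')\subseteq T'$ iff $T''\subseteq G(T')$. A theory $T'$ of $L'$ is $L''$-derivable from a theory $T$ of $L'$ if $T'=T+F(T''_0)$ for some theory $T''_0$ of $L''$. A theory $T$ of $L'$ is Hilbert-Post complete with respect to $L''$ if it is consistent and every theory of $L'$ containing $T$ is $L''$-derivable from $T$. -}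

module Defs where

open import Level using (0ℓ)
open import Data.Product using (Σ; _×_; ∃)
open import Relation.Binary.PropositionalEquality using (_≡_)
open import Relation.Nullary using (¬_)
open import Relation.Unary using (Pred; _⊆_; _≐_; _∪_; U)
open import Function.Definitions using (Injective)

record Logic : Set₁ where
  field
    Form  : Set
    Rule  : Set
    prem  : Rule → Pred Form 0ℓ
    concl : Rule → Form
open Logic public

data Der (L : Logic) (Γ : Pred (Form L) 0ℓ) : Pred (Form L) 0ℓ where
  hyp : ∀ {φ} → Γ φ → Der L Γ φ
  app : (r : Rule L) → (∀ ψ → prem L r ψ → Der L Γ ψ) → Der L Γ (concl L r)

IsTheory : (L : Logic) → Pred (Form L) 0ℓ → Set
IsTheory L T = ∀ (r : Rule L) → prem L r ⊆ T → T (concl L r)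

Gen : (L : Logic) → Pred (Form L) 0ℓ → Pred (Form L) 0ℓ
Gen L Γ = Der L Γ

Tmax : (L : Logic) → Pred (Form L) 0ℓ
Tmax L = U

Sum : (L : Logic) → Pred (Form L) 0ℓ → Pred (Form L) 0ℓ → Pred (Form L) 0ℓ
Sum L T T' = Gen L (T ∪ T')

Consistent : (L : Logic) → Pred (Form L) 0ℓ → Set
Consistent L T = ¬ (T ≐ Tmax L)

Image : {A B : Set} → (A → B) → Pred A 0ℓ → Pred B 0ℓ
Image f P b = ∃ λ a → P a × f a ≡ b

record Extension (L' L'' : Logic) : Set where
  field
    ι        : Form L'' → Form L'
    ι-inj    : Injective _≡_ _≡_ ι
    ruleι    : Rule L'' → Rule L'
    prem-ι   : ∀ r → prem L' (ruleι r) ≐ Image ι (prem L'' r)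
    concl-ι  : ∀ r → concl L' (ruleι r) ≡ ι (concl L'' r)
open Extension public

F : {L' L'' : Logic} → Extension L' L'' → Pred (Form L'') 0ℓ → Pred (Form L') 0ℓ
F {L'} E T'' = Gen L' (Image (ι E) T'')

G : {L' L'' : Logic} → Extension L' L'' → Pred (Form L') 0ℓ → Pred (Form L'') 0ℓ
G E T' φ = T' (ι E φ)

LDerivable : (L' L'' : Logic) → (Pred (Form L'') 0ℓ → Pred (Form L') 0ℓ)
           → Pred (Form L') 0ℓ → Pred (Form L') 0ℓ → Set₁
LDerivable L' L'' F' T T' =
  Σ (Pred (Form L'') 0ℓ) λ T₀ → IsTheory L'' T₀ × (T' ≐ Sum L' T (F' T₀))

HPComplete : (L' L'' : Logic) → (Pred (Form L'') 0ℓ → Pred (Form L') 0ℓ)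
           → Pred (Form L') 0ℓ → Set₁
HPComplete L' L'' F' T =
  IsTheory L' T × Consistent L' T ×
  (∀ (T' : Pred (Form L') 0ℓ) → IsTheory L' T' → T ⊆ T' → LDerivable L' L'' F' T T')

-- If T' ⊇ T, complete w.r.t. L₁ gives T' = T + F₂(G₂ T'), and G₂ T' ⊇ T₁ is a theory of L₁,
-- so completeness of T₁ gives G₂ T' = T₁ + F₁ S₀. Pushing this forward along F₂, which
-- sends T₁ to T, yields T' = T + F₂ (F₁ S₀).
module Submission where

open import Defs
open import Level using (0ℓ)
open import Relation.Unary using (Pred; _⊆_)
open import Data.Product using (_,_; proj₁)
open import Data.Sum using (inj₁; inj₂)
open import Relation.Binary.PropositionalEquality using (refl; subst)

module _ (L : Logic) where

  Der-isTheory : (Γ : Pred (Form L) 0ℓ) → IsTheory L (Der L Γ)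
  Der-isTheory _ r prems = app r (λ ψ → prems)

  Der-least : {Γ X : Pred (Form L) 0ℓ} → IsTheory L X → Γ ⊆ X → Der L Γ ⊆ X
  Der-least X-theory Γ⊆X (hyp γ)        = Γ⊆X γ
  Der-least X-theory Γ⊆X (app r derivs) =
    X-theory r (λ {ψ} p → Der-least X-theory Γ⊆X (derivs ψ p))

  Sumˡ : {A B : Pred (Form L) 0ℓ} → A ⊆ Sum L A B
  Sumˡ a = hyp (inj₁ a)

  Sumʳ : {A B : Pred (Form L) 0ℓ} → B ⊆ Sum L A B
  Sumʳ b = hyp (inj₂ b)

  Sum-least : {A B X : Pred (Form L) 0ℓ} → IsTheory L X → A ⊆ X → B ⊆ X → Sum L A B ⊆ X
  Sum-least X-theory A⊆X B⊆X = Der-least X-theory λ where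
    (inj₁ a) → A⊆X a
    (inj₂ b) → B⊆X b

  Sum-monoʳ : {A B B' : Pred (Form L) 0ℓ} → B ⊆ B' → Sum L A B ⊆ Sum L A B'
  Sum-monoʳ B⊆B' = Sum-least (Der-isTheory _) Sumˡ (λ b → Sumʳ (B⊆B' b))

module _ {L' L'' : Logic} (E : Extension L' L'') where

  G-isTheory : {X : Pred (Form L') 0ℓ} → IsTheory L' X → IsTheory L'' (G E X)
  G-isTheory {X} X-theory r prems =
    subst X (concl-ι E r) (X-theory (ruleι E r) (λ p → ι-prem (proj₁ (prem-ι E r) p)))
    where
    ι-prem : Image (ι E) (prem L'' r) ⊆ X
    ι-prem (ψ , p , refl) = prems p

  F⊆⇒⊆G : {Y : Pred (Form L'') 0ℓ} {X : Pred (Form L') 0ℓ} → F E Y ⊆ X → Y ⊆ G E X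
  F⊆⇒⊆G FY⊆X y = FY⊆X (hyp (_ , y , refl))

  ⊆G⇒F⊆ : {Y : Pred (Form L'') 0ℓ} {X : Pred (Form L') 0ℓ}
    → IsTheory L' X → Y ⊆ G E X → F E Y ⊆ X
  ⊆G⇒F⊆ X-theory Y⊆GX = Der-least L' X-theory λ where (_ , y , refl) → Y⊆GX y

  F-mono : {Y Y' : Pred (Form L'') 0ℓ} → Y ⊆ Y' → F E Y ⊆ F E Y'
  F-mono Y⊆Y' = ⊆G⇒F⊆ (Der-isTheory L' _) (λ y → F⊆⇒⊆G (λ u → u) (Y⊆Y' y))

  LDerivable⇒⊆Sum-FG : {T T' : Pred (Form L') 0ℓ}
    → LDerivable L' L'' (F E) T T' → T' ⊆ Sum L' T (F E (G E T'))
  LDerivable⇒⊆Sum-FG {T' = T'} (S , _ , T'⊆T+FS , T+FS⊆T') t' =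
    Sum-monoʳ L' (F-mono S⊆GT') (T'⊆T+FS t')
    where
    S⊆GT' : S ⊆ G E T'
    S⊆GT' = F⊆⇒⊆G (λ u → T+FS⊆T' (Sumʳ L' u))

module _ {L₀ L₁ L : Logic} (E₁ : Extension L₁ L₀) (E₂ : Extension L L₁) where

  LDerivable-∘ : {T₁ : Pred (Form L₁) 0ℓ} {T' : Pred (Form L) 0ℓ}
    → IsTheory L T' → F E₂ T₁ ⊆ T'
    → LDerivable L L₁ (F E₂) (F E₂ T₁) T'
    → LDerivable L₁ L₀ (F E₁) T₁ (G E₂ T')
    → LDerivable L L₀ (λ X → F E₂ (F E₁ X)) (F E₂ T₁) T'
  LDerivable-∘ {T₁} {T'} T'-theory T⊆T' T'-derivable (S₀ , S₀-theory , GT'⊆T₁+FS₀ , T₁+FS₀⊆GT') =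
    S₀ , S₀-theory , T'⊆Target , Target⊆T'
    where
    Target = Sum L (F E₂ T₁) (F E₂ (F E₁ S₀))

    GT'⊆GTarget : G E₂ T' ⊆ G E₂ Target
    GT'⊆GTarget t = Sum-least L₁ (G-isTheory E₂ (Der-isTheory L _))
      (F⊆⇒⊆G E₂ {X = Target} (Sumˡ L)) (F⊆⇒⊆G E₂ {X = Target} (Sumʳ L)) (GT'⊆T₁+FS₀ t)

    T'⊆Target : T' ⊆ Target
    T'⊆Target t' = Sum-least L (Der-isTheory L _) (Sumˡ L)
      (⊆G⇒F⊆ E₂ (Der-isTheory L _) GT'⊆GTarget)
      (LDerivable⇒⊆Sum-FG E₂ T'-derivable t')

    Target⊆T' : Target ⊆ T'
    Target⊆T' = Sum-least L T'-theory T⊆T'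
      (⊆G⇒F⊆ E₂ T'-theory (λ u → T₁+FS₀⊆GT' (Sumʳ L₁ u)))

proposition2p7 : (L₀ L₁ L : Logic) (E₁ : Extension L₁ L₀) (E₂ : Extension L L₁)
    → (T₀ : Pred (Form L₀) 0ℓ) → IsTheory L₀ T₀
    → HPComplete L₁ L₀ (F E₁) (F E₁ T₀)
    → HPComplete L L₁ (F E₂) (F E₂ (F E₁ T₀))
    → HPComplete L L₀ (λ X → F E₂ (F E₁ X)) (F E₂ (F E₁ T₀))
proposition2p7 L₀ L₁ L E₁ E₂ T₀ _ (_ , _ , T₁-complete) (T-theory , T-consistent , T-complete) =
  T-theory , T-consistent , complete
  where
  complete : ∀ T' → IsTheory L T' → F E₂ (F E₁ T₀) ⊆ T'
    → LDerivable L L₀ (λ X → F E₂ (F E₁ X)) (F E₂ (F E₁ T₀)) T'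
  complete T' T'-theory T⊆T' =
    LDerivable-∘ E₁ E₂ T'-theory T⊆T' (T-complete T' T'-theory T⊆T')
      (T₁-complete (G E₂ T') (G-isTheory E₂ T'-theory) (F⊆⇒⊆G E₂ T⊆T'))
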